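{- Let $G$ be a finite simple graph with maximum degree $\Delta\geq 3$, and let $v$ be a vertex of degree $d$. Assume that $G$ has a locally identifying colouring $c$ using strictly more than $2d(\Delta-1)$ colours. Then there is a list $L$ of colours with $|L|\leq 2d(\Delta-1)$ such that if we change the colour of $v$ (and only of $v$) to any colour not in $L$, the resulting colouring is still locally identifying.
   Context: For a vertex $u$, $N[u]$ is its closed neighbourhood (the vertex together with its neighbours); for a colouring $c$ and vertex set $S$, $c(S)=\{c(u):u\in S\}$. A locally identifying colouring is a proper vertex colouring $c$ such that for every pair of adjacent vertices $u,v$ with $N[u]\neq N[v]$, $c(N[u])\neq c(N[v])$. -}

module Defs where

open import Data.Nat using (ℕ; _≤_; _<_; _*_; _∸_)
open import Data.Nat.Properties using () renaming (_≟_ to _≟ℕ_)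
open import Data.Fin using (Fin)
open import Data.Fin.Properties using () renaming (_≟_ to _≟F_)
open import Data.Bool using (Bool; true; false; T; if_then_else_)
open import Data.Bool.Properties using (T?)
open import Data.List using (List; length; filter; map; deduplicate)
open import Data.List.Membership.Propositional using (_∈_)
open import Data.Fin.Base using () 
open import Data.List using (List)
open import Data.Product using (Σ; ∃; _×_)
open import Data.Sum using (_⊎_)
open import Relation.Binary.PropositionalEquality using (_≡_; _≢_)
open import Relation.Nullary using (¬_; does)
open import Function.Bundles using (_⇔_)
import Data.List.Base as L
open import Data.Fin.Base using (Fin)

allVertices : (n : ℕ) → List (Fin n)
allVertices n = L.allFin n

record SimpleGraph (n : ℕ) : Set where
  field
    adj    : Fin n → Fin n → Bool
    sym    : ∀ u v → adj u v ≡ adj v u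
    irrefl : ∀ u → adj u u ≡ false

module _ {n : ℕ} (G : SimpleGraph n) where
  open SimpleGraph G

  Adj : Fin n → Fin n → Set
  Adj u v = T (adj u v)

  degree : Fin n → ℕ
  degree u = length (filter (λ w → T? (adj u w)) (allVertices n))

  IsMaxDegree : ℕ → Set
  IsMaxDegree Δ = (∀ u → degree u ≤ Δ) × ∃ λ u → degree u ≡ Δ

  InN : Fin n → Fin n → Set
  InN u w = (w ≡ u) ⊎ Adj u w

  SameN : Fin n → Fin n → Set
  SameN u v = ∀ w → InN u w ⇔ InN v w

  InColN : (Fin n → ℕ) → Fin n → ℕ → Set
  InColN c u k = ∃ λ w → InN u w × c w ≡ k

  SameColN : (Fin n → ℕ) → Fin n → Fin n → Set
  SameColN c u v = ∀ k → InColN c u k ⇔ InColN c v k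

  Proper : (Fin n → ℕ) → Set
  Proper c = ∀ u v → Adj u v → c u ≢ c v

  LocallyIdentifying : (Fin n → ℕ) → Set
  LocallyIdentifying c =
    Proper c × (∀ u v → Adj u v → ¬ SameN u v → ¬ SameColN c u v)

numColours : {n : ℕ} → (Fin n → ℕ) → ℕ
numColours {n} c = length (deduplicate _≟ℕ_ (map c (allVertices n)))

recolour : {n : ℕ} → (Fin n → ℕ) → Fin n → ℕ → Fin n → ℕ
recolour c v k u = if does (u ≟F v) then k else c u

module Submission where

-- Let C(u) be the set of colours of N[u] ∖ {v}. After recolouring v with k, N[x] carries the colours
-- C(x), plus k when v ∈ N[x]. If this makes adjacent x, y with N[x] ≠ N[y] indistinguishable, then
-- one of them is a neighbour u of v, and for the other one w the sets C(u), C(w) agree up to k. As c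
-- separates u and w, either k ∈ C(w) ⊆ C(u), or k is the unique element of C(w) ∖ C(u) (after
-- possibly swapping u and w when both are neighbours of v), or w = v and k is the unique element of
-- C(u) ∖ C(v). So it suffices to forbid, for each neighbour u of v: c(u); the first element of
-- C(w) ∖ C(u) for each neighbour w ≠ v of u; and all of C(u) if some such w has C(w) ⊆ C(u) (that w
-- then contributes nothing), otherwise the first element of C(u) ∖ C(v). These are at most
-- Δ + (Δ − 2), resp. 2 + (Δ − 1), colours, both at most 2(Δ − 1) as Δ ≥ 3.

open import Defs
open import Data.Nat using (ℕ; suc; _+_; _*_; _∸_; _≤_; _<_; z≤n; s≤s)
open import Data.Nat.Properties
  using ( module ≤-Reasoning; ≤-trans; ≤-refl; ≤-reflexive; ≤-pred; +-suc; +-mono-≤; +-monoʳ-≤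
        ; +-identityʳ; *-identityʳ; *-distribˡ-+; *-distribʳ-+)
  renaming (_≟_ to _≟ℕ_)
open import Data.Fin using (Fin)
open import Data.Fin.Properties using () renaming (_≟_ to _≟F_)
open import Data.Bool using (T)
open import Data.Bool.Properties using (T?)
open import Data.List using (List; []; _∷_; _++_; length; map; filter; take; concatMap)
open import Data.List.Properties using (length-++; length-map; filter-none; filter-notAll)
open import Data.List.Membership.Propositional using (_∈_; _∉_)
open import Data.List.Membership.Propositional.Properties
  using (∈-filter⁺; ∈-filter⁻; ∈-map⁺; ∈-map⁻; ∈-allFin; ∈-++⁺ˡ; ∈-++⁺ʳ; ∈-concat⁺′)
open import Data.List.Relation.Binary.Subset.Propositional using (_⊆_; _⊈_)
open import Data.List.Relation.Unary.All as All using (All)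
open import Data.List.Relation.Unary.Any as Any using (Any; here; there; any?)
import Data.List.Membership.DecPropositional as DecMembership
import Data.List.Relation.Binary.Subset.DecPropositional as DecSubset
open import Data.Product using (Σ; _×_; _,_; proj₁; proj₂)
open import Data.Sum using (_⊎_; inj₁; inj₂)
open import Data.Empty using (⊥; ⊥-elim)
open import Relation.Nullary using (¬_; Dec; yes; no; ¬?)
open import Relation.Nullary.Decidable using (_⊎-dec_)
open import Relation.Binary.Definitions using (DecidableEquality)
open import Relation.Binary.PropositionalEquality using (_≡_; _≢_; refl; sym; trans; cong; subst; module ≡-Reasoning)
open import Function using (_∘′_)
open import Function.Bundles using (_⇔_; mk⇔; Equivalence)

module _ {A : Set} where

  length-take-1 : (xs : List A) → length (take 1 xs) ≤ 1
  length-take-1 []       = z≤n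
  length-take-1 (x ∷ xs) = s≤s z≤n

  take-1-⊆ : (xs : List A) → take 1 xs ⊆ xs
  take-1-⊆ (x ∷ xs) (here eq) = here eq

  ∈-take-1 : ∀ {k} {xs : List A} → All (_≡ k) xs → k ∈ xs → k ∈ take 1 xs
  ∈-take-1 (x≡k All.∷ _) _ = here (sym x≡k)

module _ {A B : Set} (f : A → List B) where

  ∈-concatMap⁺ : ∀ {x y} {xs : List A} → x ∈ xs → y ∈ f x → y ∈ concatMap f xs
  ∈-concatMap⁺ x∈xs y∈fx = ∈-concat⁺′ y∈fx (∈-map⁺ f x∈xs)

  length-concatMap-≤ : ∀ m (xs : List A) → (∀ {x} → x ∈ xs → length (f x) ≤ m) →
                       length (concatMap f xs) ≤ length xs * m
  length-concatMap-≤ m []       _     = z≤n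
  length-concatMap-≤ m (x ∷ xs) bound rewrite length-++ (f x) {concatMap f xs} =
    +-mono-≤ (bound (here refl)) (length-concatMap-≤ m xs (λ p → bound (there p)))

  length-concatMap-< : (∀ x → length (f x) ≤ 1) → ∀ {xs} → Any (λ x → f x ≡ []) xs →
                       length (concatMap f xs) < length xs
  length-concatMap-< short {x ∷ xs} (here fx≡[]) rewrite fx≡[] =
    s≤s (≤-trans (length-concatMap-≤ 1 xs (λ {y} _ → short y)) (≤-reflexive (*-identityʳ (length xs))))
  length-concatMap-< short {x ∷ xs} (there p) rewrite length-++ (f x) {concatMap f xs} =
    ≤-trans (≤-reflexive (sym (+-suc (length (f x)) _))) (+-mono-≤ (short x) (length-concatMap-< short p))

module FiniteSets {A : Set} (_≟_ : DecidableEquality A) where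
  open DecMembership _≟_ using (_∈?_)

  infixl 5 _∖_
  _∖_ : List A → List A → List A
  xs ∖ ys = filter (λ x → ¬? (x ∈? ys)) xs

  ∈-∖⁺ : ∀ {x xs ys} → x ∈ xs → x ∉ ys → x ∈ xs ∖ ys
  ∈-∖⁺ {ys = ys} = ∈-filter⁺ (λ x → ¬? (x ∈? ys))

  ∈-∖⁻ : ∀ {x} xs ys → x ∈ xs ∖ ys → x ∈ xs × x ∉ ys
  ∈-∖⁻ xs ys = ∈-filter⁻ (λ x → ¬? (x ∈? ys)) {xs = xs}

  ⊆⇒∖≡[] : ∀ {xs ys} → xs ⊆ ys → xs ∖ ys ≡ []
  ⊆⇒∖≡[] {ys = ys} xs⊆ys =
    filter-none (λ x → ¬? (x ∈? ys)) (All.tabulate (λ x∈xs x∉ys → x∉ys (xs⊆ys x∈xs)))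

  ∈-take-1-∖ : ∀ {k xs ys} → ys ⊆ k ∷ xs → ys ⊈ xs → k ∈ take 1 (ys ∖ xs)
  ∈-take-1-∖ {k} {xs} {ys} ys⊆k∷xs ys⊈xs = ∈-take-1 (All.tabulate onlyK) k∈ys∖xs
    where
    onlyK : ∀ {x} → x ∈ ys ∖ xs → x ≡ k
    onlyK {x} p with ∈-∖⁻ ys xs p
    ... | x∈ys , x∉xs with ys⊆k∷xs x∈ys
    ... | here x≡k = x≡k
    ... | there x∈xs = ⊥-elim (x∉xs x∈xs)
    ⊆-if-k : (k ∈ ys → k ∈ xs) → ys ⊆ xs
    ⊆-if-k k∈ys⇒k∈xs x∈ys with ys⊆k∷xs x∈ys
    ... | here refl = k∈ys⇒k∈xs x∈ys
    ... | there x∈xs = x∈xs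
    k∈ys∖xs : k ∈ ys ∖ xs
    k∈ys∖xs with k ∈? xs | k ∈? ys
    ... | no k∉xs  | yes k∈ys = ∈-∖⁺ k∈ys k∉xs
    ... | yes k∈xs | _        = ⊥-elim (ys⊈xs (⊆-if-k (λ _ → k∈xs)))
    ... | no _     | no k∉ys  = ⊥-elim (ys⊈xs (⊆-if-k (λ k∈ys → ⊥-elim (k∉ys k∈ys))))

module Neighbourhoods {n : ℕ} (G : SimpleGraph n) where
  open SimpleGraph G using (adj; irrefl) renaming (sym to adj-sym)

  nbrs : Fin n → List (Fin n)
  nbrs u = filter (λ w → T? (adj u w)) (allVertices n)

  ∈-nbrs⁺ : ∀ {u w} → Adj G u w → w ∈ nbrs u
  ∈-nbrs⁺ {u} {w} = ∈-filter⁺ (λ w → T? (adj u w)) (∈-allFin w)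

  ∈-nbrs⁻ : ∀ {u w} → w ∈ nbrs u → Adj G u w
  ∈-nbrs⁻ {u} p = proj₂ (∈-filter⁻ (λ w → T? (adj u w)) {xs = allVertices n} p)

  Adj-sym : ∀ {u w} → Adj G u w → Adj G w u
  Adj-sym {u} {w} = subst T (adj-sym u w)

  Adj⇒≢ : ∀ {u w} → Adj G u w → u ≢ w
  Adj⇒≢ {u} a refl = subst T (irrefl u) a

  InN? : ∀ u w → Dec (InN G u w)
  InN? u w = (w ≟F u) ⊎-dec T? (adj u w)

  InN⇒∈closed : ∀ {u w} → InN G u w → w ∈ u ∷ nbrs u
  InN⇒∈closed (inj₁ refl) = here refl
  InN⇒∈closed (inj₂ a)    = there (∈-nbrs⁺ a)

  ∈closed⇒InN : ∀ {u w} → w ∈ u ∷ nbrs u → InN G u w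
  ∈closed⇒InN (here eq) = inj₁ eq
  ∈closed⇒InN (there p) = inj₂ (∈-nbrs⁻ p)

  SameColN-sym : ∀ {c x y} → SameColN G c x y → SameColN G c y x
  SameColN-sym same k = mk⇔ (Equivalence.from (same k)) (Equivalence.to (same k))

module Construction {n : ℕ} (G : SimpleGraph n) (c : Fin n → ℕ) (v : Fin n) where
  open Neighbourhoods G
  open FiniteSets _≟ℕ_
  open DecSubset _≟ℕ_ using (_⊆?_)
  open DecMembership _≟ℕ_ using (_∈?_)

  nbrs∖v : Fin n → List (Fin n)
  nbrs∖v u = filter (λ w → ¬? (w ≟F v)) (nbrs u)

  colours∖v : Fin n → List ℕ
  colours∖v u = map c (filter (λ w → ¬? (w ≟F v)) (u ∷ nbrs u))

  ∈-nbrs∖v⁺ : ∀ {u w} → Adj G u w → w ≢ v → w ∈ nbrs∖v u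
  ∈-nbrs∖v⁺ a = ∈-filter⁺ (λ w → ¬? (w ≟F v)) (∈-nbrs⁺ a)

  ∈-colours∖v⁺ : ∀ {u w} → InN G u w → w ≢ v → c w ∈ colours∖v u
  ∈-colours∖v⁺ u∋w w≢v = ∈-map⁺ c (∈-filter⁺ (λ w → ¬? (w ≟F v)) (InN⇒∈closed u∋w) w≢v)

  ∈-colours∖v⁻ : ∀ {u j} → j ∈ colours∖v u → Σ (Fin n) λ w → InN G u w × w ≢ v × j ≡ c w
  ∈-colours∖v⁻ {u} p with ∈-map⁻ c p
  ... | w , q , j≡cw with ∈-filter⁻ (λ w → ¬? (w ≟F v)) {xs = u ∷ nbrs u} q
  ... | w∈N[u] , w≢v = w , ∈closed⇒InN w∈N[u] , w≢v , j≡cw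

  InColN-split : (g : Fin n → ℕ) → (∀ {w} → w ≢ v → g w ≡ c w) → ∀ x j →
                 InColN G g x j ⇔ ((InN G x v × j ≡ g v) ⊎ j ∈ colours∖v x)
  InColN-split g g≗c x j = mk⇔ split join
    where
    split : InColN G g x j → (InN G x v × j ≡ g v) ⊎ j ∈ colours∖v x
    split (w , x∋w , gw≡j) with w ≟F v
    ... | yes refl = inj₁ (x∋w , sym gw≡j)
    ... | no w≢v   = inj₂ (subst (_∈ colours∖v x) (trans (sym (g≗c w≢v)) gw≡j) (∈-colours∖v⁺ x∋w w≢v))
    join : (InN G x v × j ≡ g v) ⊎ j ∈ colours∖v x → InColN G g x j
    join (inj₁ (x∋v , j≡gv)) = v , x∋v , sym j≡gv
    join (inj₂ p) with ∈-colours∖v⁻ p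
    ... | w , x∋w , w≢v , j≡cw = w , x∋w , trans (g≗c w≢v) (sym j≡cw)

  ∈-nbrs-v : ∀ {u} → InN G u v → u ≢ v → u ∈ nbrs v
  ∈-nbrs-v (inj₁ v≡u) u≢v = ⊥-elim (u≢v (sym v≡u))
  ∈-nbrs-v (inj₂ a)   _   = ∈-nbrs⁺ (Adj-sym a)

  sameColN : ∀ {x y} → (InN G x v → InN G y v) → (InN G y v → InN G x v) →
             colours∖v x ⊆ colours∖v y → colours∖v y ⊆ colours∖v x → SameColN G c x y
  sameColN x∋v⇒y∋v y∋v⇒x∋v x⊆y y⊆x j = mk⇔ (transport x∋v⇒y∋v x⊆y) (transport y∋v⇒x∋v y⊆x)
    where
    split : ∀ x → InColN G c x j ⇔ ((InN G x v × j ≡ c v) ⊎ j ∈ colours∖v x)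
    split x = InColN-split c (λ _ → refl) x j
    transport : ∀ {x y} → (InN G x v → InN G y v) → colours∖v x ⊆ colours∖v y →
                InColN G c x j → InColN G c y j
    transport {x} {y} x∋v⇒y∋v x⊆y p with Equivalence.to (split x) p
    ... | inj₁ (x∋v , j≡cv) = Equivalence.from (split y) (inj₁ (x∋v⇒y∋v x∋v , j≡cv))
    ... | inj₂ q            = Equivalence.from (split y) (inj₂ (x⊆y q))

  differ∖v : ∀ {x y} → InN G x v → InN G y v → ¬ SameColN G c x y →
             ¬ (colours∖v x ⊆ colours∖v y × colours∖v y ⊆ colours∖v x)
  differ∖v x∋v y∋v differ (x⊆y , y⊆x) = differ (sameColN (λ _ → y∋v) (λ _ → x∋v) x⊆y y⊆x)

  gap : Fin n → Fin n → List ℕ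
  gap u w = take 1 (colours∖v w ∖ colours∖v u)

  gaps : Fin n → List ℕ
  gaps u = concatMap (gap u) (nbrs∖v u)

  Subsumed : Fin n → Set
  Subsumed u = Any (λ w → colours∖v w ⊆ colours∖v u) (nbrs∖v u)

  subsumed? : ∀ u → Dec (Subsumed u)
  subsumed? u = any? (λ w → colours∖v w ⊆? colours∖v u) (nbrs∖v u)

  base : ∀ u → Dec (Subsumed u) → List ℕ
  base u (yes _) = colours∖v u
  base u (no _)  = c u ∷ gap v u

  forbiddenAt : Fin n → List ℕ
  forbiddenAt u = base u (subsumed? u) ++ gaps u

  forbidden : List ℕ
  forbidden = concatMap forbiddenAt (nbrs v)

  forbiddenAt⊆forbidden : ∀ {u} → u ∈ nbrs v → forbiddenAt u ⊆ forbidden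
  forbiddenAt⊆forbidden u∈N[v] = ∈-concatMap⁺ forbiddenAt u∈N[v]

  gap⊆forbiddenAt : ∀ {u w} → w ∈ nbrs∖v u → gap u w ⊆ forbiddenAt u
  gap⊆forbiddenAt {u} w∈N[u] p = ∈-++⁺ʳ (base u (subsumed? u)) (∈-concatMap⁺ (gap u) w∈N[u] p)

  colour∈forbiddenAt : ∀ {u} → u ≢ v → c u ∈ forbiddenAt u
  colour∈forbiddenAt {u} u≢v with subsumed? u
  ... | yes _ = ∈-++⁺ˡ (∈-colours∖v⁺ (inj₁ refl) u≢v)
  ... | no _  = here refl

  subsumed⇒colours∖v⊆forbiddenAt : ∀ {u} → Subsumed u → colours∖v u ⊆ forbiddenAt u
  subsumed⇒colours∖v⊆forbiddenAt {u} s p with subsumed? u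
  ... | yes _ = ∈-++⁺ˡ p
  ... | no ¬s = ⊥-elim (¬s s)

  gap-v⊆forbiddenAt : ∀ {u} → gap v u ⊆ forbiddenAt u
  gap-v⊆forbiddenAt {u} p with subsumed? u
  ... | yes _ = ∈-++⁺ˡ (proj₁ (∈-∖⁻ (colours∖v u) (colours∖v v) (take-1-⊆ _ p)))
  ... | no _  = ∈-++⁺ˡ (there p)

  colour∈forbidden : ∀ {u} → u ∈ nbrs v → c u ∈ forbidden
  colour∈forbidden u∈N[v] =
    forbiddenAt⊆forbidden u∈N[v] (colour∈forbiddenAt (λ { refl → Adj⇒≢ (∈-nbrs⁻ u∈N[v]) refl }))

  colours∖v-v⊆forbidden : colours∖v v ⊆ forbidden
  colours∖v-v⊆forbidden p with ∈-colours∖v⁻ p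
  ... | w , inj₁ refl , w≢v , _    = ⊥-elim (w≢v refl)
  ... | w , inj₂ a    , _   , refl = colour∈forbidden (∈-nbrs⁺ a)

  module Size (D : ℕ) (2≤D : 2 ≤ D) (maxDegree : ∀ u → degree G u ≤ suc D) where

    length-nbrs∖v : ∀ {u} → u ∈ nbrs v → length (nbrs∖v u) ≤ D
    length-nbrs∖v {u} u∈N[v] =
      ≤-pred (≤-trans (filter-notAll (λ w → ¬? (w ≟F v)) (nbrs u) v∈N[u]) (maxDegree u))
      where v∈N[u] = Any.map (λ { refl v≢v → v≢v refl }) (∈-nbrs⁺ (Adj-sym (∈-nbrs⁻ u∈N[v])))

    length-colours∖v : ∀ {u} → u ∈ nbrs v → length (colours∖v u) ≤ suc D
    length-colours∖v {u} u∈N[v] rewrite length-map c (filter (λ w → ¬? (w ≟F v)) (u ∷ nbrs u)) =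
      ≤-pred (≤-trans (filter-notAll (λ w → ¬? (w ≟F v)) (u ∷ nbrs u) v∈N[u]) (s≤s (maxDegree u)))
      where v∈N[u] = there (Any.map (λ { refl v≢v → v≢v refl }) (∈-nbrs⁺ (Adj-sym (∈-nbrs⁻ u∈N[v]))))

    length-gap : ∀ u w → length (gap u w) ≤ 1
    length-gap u w = length-take-1 (colours∖v w ∖ colours∖v u)

    length-gaps : ∀ u → length (gaps u) ≤ length (nbrs∖v u)
    length-gaps u = ≤-trans (length-concatMap-≤ (gap u) 1 (nbrs∖v u) (λ {w} _ → length-gap u w))
                            (≤-reflexive (*-identityʳ _))

    length-gaps-< : ∀ {u} → Subsumed u → length (gaps u) < length (nbrs∖v u)
    length-gaps-< {u} = length-concatMap-< (gap u) (length-gap u) ∘′ Any.map (λ {w} → no-gap {w})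
      where
      no-gap : ∀ {w} → colours∖v w ⊆ colours∖v u → gap u w ≡ []
      no-gap {w} w⊆u = cong (take 1) (⊆⇒∖≡[] {colours∖v w} w⊆u)

    length-forbiddenAt : ∀ {u} → u ∈ nbrs v → length (forbiddenAt u) ≤ D + D
    length-forbiddenAt {u} u∈N[v] with subsumed? u
    ... | yes s = begin
      length (colours∖v u ++ gaps u)       ≡⟨ length-++ (colours∖v u) ⟩
      length (colours∖v u) + length (gaps u) ≤⟨ +-mono-≤ (length-colours∖v u∈N[v]) ≤-refl ⟩
      suc D + length (gaps u)              ≡⟨ sym (+-suc D _) ⟩
      D + suc (length (gaps u))            ≤⟨ +-monoʳ-≤ D (≤-trans (length-gaps-< s) (length-nbrs∖v u∈N[v])) ⟩
      D + D                                ∎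
      where open ≤-Reasoning
    ... | no _ = begin
      suc (length (gap v u ++ gaps u))          ≡⟨ cong suc (length-++ (gap v u)) ⟩
      suc (length (gap v u) + length (gaps u))
        ≤⟨ s≤s (+-mono-≤ (length-gap v u) (≤-trans (length-gaps u) (length-nbrs∖v u∈N[v]))) ⟩
      2 + D                                     ≤⟨ +-mono-≤ 2≤D (≤-refl {D}) ⟩
      D + D                                     ∎
      where open ≤-Reasoning

    length-forbidden : length forbidden ≤ degree G v * (D + D)
    length-forbidden = length-concatMap-≤ forbiddenAt (D + D) (nbrs v) length-forbiddenAt

  module Recoloured (k : ℕ) where

    c′ : Fin n → ℕ
    c′ = recolour c v k

    recolour-≢ : ∀ {w} → w ≢ v → c′ w ≡ c w
    recolour-≢ {w} w≢v with w ≟F v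
    ... | yes w≡v = ⊥-elim (w≢v w≡v)
    ... | no _    = refl

    recolour-≡ : c′ v ≡ k
    recolour-≡ with v ≟F v
    ... | yes _   = refl
    ... | no v≢v  = ⊥-elim (v≢v refl)

    Seen : Fin n → ℕ → Set
    Seen x j = (InN G x v × j ≡ k) ⊎ j ∈ colours∖v x

    InColN-recolour : ∀ x j → InColN G c′ x j ⇔ Seen x j
    InColN-recolour x j = mk⇔
      (λ p → retag recolour-≡ (Equivalence.to (InColN-split c′ recolour-≢ x j) p))
      (λ p → Equivalence.from (InColN-split c′ recolour-≢ x j) (retag (sym recolour-≡) p))
      where
      retag : ∀ {a b} → a ≡ b → (InN G x v × j ≡ a) ⊎ j ∈ colours∖v x → (InN G x v × j ≡ b) ⊎ j ∈ colours∖v x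
      retag a≡b (inj₁ (x∋v , j≡a)) = inj₁ (x∋v , trans j≡a a≡b)
      retag a≡b (inj₂ p)           = inj₂ p

    module _ {x y} (same : SameColN G c′ x y) where

      seen-transfer : ∀ {j} → Seen x j → Seen y j
      seen-transfer {j} =
        Equivalence.to (InColN-recolour y j) ∘′ Equivalence.to (same j) ∘′ Equivalence.from (InColN-recolour x j)

      colours∖v-⊆-k∷ : colours∖v x ⊆ k ∷ colours∖v y
      colours∖v-⊆-k∷ p with seen-transfer (inj₂ p)
      ... | inj₁ (_ , j≡k) = here j≡k
      ... | inj₂ q         = there q

      colours∖v-⊆ : ¬ InN G y v → colours∖v x ⊆ colours∖v y
      colours∖v-⊆ y∌v p with seen-transfer (inj₂ p)
      ... | inj₁ (y∋v , _) = ⊥-elim (y∌v y∋v)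
      ... | inj₂ q         = q

      k∈colours∖v : InN G x v → ¬ InN G y v → k ∈ colours∖v y
      k∈colours∖v x∋v y∌v with seen-transfer (inj₁ (x∋v , refl))
      ... | inj₁ (y∋v , _) = ⊥-elim (y∌v y∋v)
      ... | inj₂ q         = q

    forbidden-outer : ∀ {x y} → x ∈ nbrs v → y ∈ nbrs∖v x →
                      colours∖v y ⊆ k ∷ colours∖v x → k ∈ colours∖v y → k ∈ forbidden
    forbidden-outer {x} {y} x∈N[v] y∈N[x] y⊆k∷x k∈y with colours∖v y ⊆? colours∖v x
    ... | yes y⊆x = forbiddenAt⊆forbidden x∈N[v] (subsumed⇒colours∖v⊆forbiddenAt subsumed (y⊆x k∈y))
      where
      subsumed : Subsumed x
      subsumed = Any.map (λ { refl {j} → y⊆x {j} }) y∈N[x]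
    ... | no y⊈x  = forbiddenAt⊆forbidden x∈N[v] (gap⊆forbiddenAt y∈N[x] (∈-take-1-∖ y⊆k∷x y⊈x))

    forbidden-inner : ∀ {x y} → x ∈ nbrs v → y ∈ nbrs v → y ∈ nbrs∖v x → x ∈ nbrs∖v y →
                      colours∖v x ⊆ k ∷ colours∖v y → colours∖v y ⊆ k ∷ colours∖v x →
                      ¬ (colours∖v x ⊆ colours∖v y × colours∖v y ⊆ colours∖v x) → k ∈ forbidden
    forbidden-inner {x} {y} x∈N[v] y∈N[v] y∈N[x] x∈N[y] x⊆k∷y y⊆k∷x differ
      with colours∖v x ⊆? colours∖v y
    ... | yes x⊆y =
      forbiddenAt⊆forbidden x∈N[v] (gap⊆forbiddenAt y∈N[x] (∈-take-1-∖ y⊆k∷x (λ y⊆x → differ (x⊆y , y⊆x))))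
    ... | no x⊈y  = forbiddenAt⊆forbidden y∈N[v] (gap⊆forbiddenAt x∈N[y] (∈-take-1-∖ x⊆k∷y x⊈y))

    forbidden-centre : ∀ {u} → u ∈ nbrs v →
                       colours∖v u ⊆ k ∷ colours∖v v → colours∖v v ⊆ k ∷ colours∖v u →
                       ¬ (colours∖v v ⊆ colours∖v u × colours∖v u ⊆ colours∖v v) → k ∈ forbidden
    forbidden-centre {u} u∈N[v] u⊆k∷v v⊆k∷u differ with k ∈? colours∖v v
    ... | yes k∈v = colours∖v-v⊆forbidden k∈v
    ... | no k∉v  = forbiddenAt⊆forbidden u∈N[v] (gap-v⊆forbiddenAt (∈-take-1-∖ u⊆k∷v u⊈v))
      where
      u⊈v : colours∖v u ⊈ colours∖v v
      u⊈v u⊆v = differ (v⊆u , u⊆v)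
        where
        v⊆u : colours∖v v ⊆ colours∖v u
        v⊆u p with v⊆k∷u p
        ... | here refl = ⊥-elim (k∉v p)
        ... | there q   = q

    recolour-proper : k ∉ forbidden → Proper G c → Proper G c′
    recolour-proper k∉F proper x y a c′x≡c′y = cases (x ≟F v) (y ≟F v)
      where
      cases : Dec (x ≡ v) → Dec (y ≡ v) → ⊥
      cases (yes refl) (yes refl) = Adj⇒≢ a refl
      cases (yes refl) (no y≢v)   = k∉F (subst (_∈ forbidden) cy≡k (colour∈forbidden (∈-nbrs⁺ a)))
        where cy≡k = trans (sym (recolour-≢ y≢v)) (trans (sym c′x≡c′y) recolour-≡)
      cases (no x≢v)   (yes refl) = k∉F (subst (_∈ forbidden) cx≡k (colour∈forbidden (∈-nbrs⁺ (Adj-sym a))))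
        where cx≡k = trans (sym (recolour-≢ x≢v)) (trans c′x≡c′y recolour-≡)
      cases (no x≢v)   (no y≢v)   = proper x y a (trans (sym (recolour-≢ x≢v)) (trans c′x≡c′y (recolour-≢ y≢v)))

    forbidden-separates : ∀ {x y} → Adj G x y → ¬ SameColN G c x y → SameColN G c′ x y → InN G x v →
                          k ∈ forbidden
    forbidden-separates {x} {y} a differ same x∋v with InN? y v | x ≟F v | y ≟F v
    ... | no y∌v  | _        | _        =
      forbidden-outer (∈-nbrs-v x∋v x≢v) (∈-nbrs∖v⁺ a y≢v)
                      (colours∖v-⊆-k∷ (SameColN-sym same)) (k∈colours∖v same x∋v y∌v)
      where
      x≢v : x ≢ v
      x≢v refl = y∌v (inj₂ (Adj-sym a))
      y≢v : y ≢ v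
      y≢v refl = y∌v (inj₁ refl)
    ... | yes _   | yes refl | yes refl = ⊥-elim (Adj⇒≢ a refl)
    ... | yes y∋v | yes refl | no y≢v   =
      forbidden-centre (∈-nbrs⁺ a) (colours∖v-⊆-k∷ (SameColN-sym same)) (colours∖v-⊆-k∷ same)
                       (differ∖v x∋v y∋v differ)
    ... | yes y∋v | no x≢v   | yes refl =
      forbidden-centre (∈-nbrs⁺ (Adj-sym a)) (colours∖v-⊆-k∷ same) (colours∖v-⊆-k∷ (SameColN-sym same))
                       (differ∖v y∋v x∋v (differ ∘′ SameColN-sym))
    ... | yes y∋v | no x≢v   | no y≢v   =
      forbidden-inner (∈-nbrs-v x∋v x≢v) (∈-nbrs-v y∋v y≢v) (∈-nbrs∖v⁺ a y≢v) (∈-nbrs∖v⁺ (Adj-sym a) x≢v)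
                      (colours∖v-⊆-k∷ same) (colours∖v-⊆-k∷ (SameColN-sym same)) (differ∖v x∋v y∋v differ)

    recolour-locallyIdentifying : k ∉ forbidden → LocallyIdentifying G c → LocallyIdentifying G c′
    recolour-locallyIdentifying k∉F (proper , identifying) = recolour-proper k∉F proper , separated
      where
      separated : ∀ x y → Adj G x y → ¬ SameN G x y → ¬ SameColN G c′ x y
      separated x y a N[x]≠N[y] same with InN? x v | InN? y v
      ... | yes x∋v | _        = k∉F (forbidden-separates a (identifying x y a N[x]≠N[y]) same x∋v)
      ... | no _    | yes y∋v  =
        k∉F (forbidden-separates (Adj-sym a) (identifying x y a N[x]≠N[y] ∘′ SameColN-sym) (SameColN-sym same) y∋v)
      ... | no x∌v  | no y∌v   = identifying x y a N[x]≠N[y]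
        (sameColN (⊥-elim ∘′ x∌v) (⊥-elim ∘′ y∌v) (colours∖v-⊆ same y∌v) (colours∖v-⊆ (SameColN-sym same) x∌v))

*-double : ∀ d D → d * (D + D) ≡ 2 * d * D
*-double d D = begin
  d * (D + D)    ≡⟨ *-distribˡ-+ d D D ⟩
  d * D + d * D  ≡⟨ sym (*-distribʳ-+ D d d) ⟩
  (d + d) * D    ≡⟨ cong (λ m → (d + m) * D) (sym (+-identityʳ d)) ⟩
  2 * d * D      ∎
  where open ≡-Reasoning

-- The bound on the number of colours of c only guarantees that a colour outside the list exists.
mainTheorem3 : (n : ℕ) (G : SimpleGraph n) (Δ : ℕ) → IsMaxDegree G Δ → 3 ≤ Δ →
    (v : Fin n) (d : ℕ) → degree G v ≡ d →
    (c : Fin n → ℕ) → LocallyIdentifying G c → 2 * d * (Δ ∸ 1) < numColours c →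
    Σ (List ℕ) λ L → (length L ≤ 2 * d * (Δ ∸ 1)) ×
    (∀ k → k ∉ L → LocallyIdentifying G (recolour c v k))
mainTheorem3 n G (suc D) (maxDegree , _) (s≤s 2≤D) v d refl c identifying _ =
  forbidden ,
  ≤-trans length-forbidden (≤-reflexive (*-double d D)) ,
  λ k k∉F → Recoloured.recolour-locallyIdentifying k k∉F identifying
  where
  open Construction G c v
  open Size D 2≤D maxDegree
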